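{- For every prime $m \geq 3$, the join graph $\Gamma(\mathbb{Z}_{2m}) + \Gamma(\mathbb{Z}_4)$ does not admit a distance antimagic labeling.
   Context: For an integer $n \geq 2$, the zero-divisor graph $\Gamma(\mathbb{Z}_n)$ is the simple graph whose vertex set is the set of nonzero zero-divisors of the ring $\mathbb{Z}_n$, two distinct vertices $u,v$ being adjacent iff $uv \equiv 0 \pmod n$. For graphs $G,H$, the join $G+H$ is the graph obtained from the disjoint union of $G$ and $H$ by adding every edge between a vertex of $G$ and a vertex of $H$. A distance antimagic labeling (DAML) of a graph $G$ with $N$ vertices is a bijection $f:V(G)\to\{1,\dots,N\}$ such that the weights $w(v)=\sum_{u\in N(v)} f(u)$, where $N(v)$ is the open neighbourhood of $v$, are pairwise distinct over all vertices $v$. A graph admits DAML if such a labeling exists. -}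

module Defs where

open import Data.Bool using (Bool; true; false; _∧_; not; if_then_else_)
open import Data.Nat using (ℕ; zero; suc; _+_; _*_; _∸_; _≡ᵇ_)
open import Data.Nat.Divisibility using (_∣?_)
open import Data.Fin using (Fin; toℕ; splitAt)
open import Data.Fin.Permutation using (Permutation′; _⟨$⟩ʳ_)
open import Data.List using (List; length; lookup; filterᵇ; applyUpTo; map; allFin)
open import Data.Bool.ListAction using (any)
open import Data.Nat.ListAction using (sum)
open import Data.Product using (Σ)
open import Data.Sum using (_⊎_; inj₁; inj₂)
open import Function.Definitions using (Injective)
open import Relation.Binary.PropositionalEquality using (_≡_)
open import Relation.Nullary.Decidable using (⌊_⌋)

record Graph : Set where
  field
    N   : ℕ
    adj : Fin N → Fin N → Bool
open Graph public

nonzeroRes : ℕ → List ℕ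
nonzeroRes n = applyUpTo suc (n ∸ 1)

prodZero : ℕ → ℕ → ℕ → Bool
prodZero n x y = ⌊ n ∣? (x * y) ⌋

isZD : ℕ → ℕ → Bool
isZD n a = any (prodZero n a) (nonzeroRes n)

zeroDivisors : ℕ → List ℕ
zeroDivisors n = filterᵇ (isZD n) (nonzeroRes n)

-- The zero-divisor graph Γ(ℤ_n): vertex i corresponds to the i-th nonzero
-- zero-divisor; distinct vertices u,v are adjacent iff uv ≡ 0 (mod n).
Γℤ : ℕ → Graph
Γℤ n = record
  { N   = length (zeroDivisors n)
  ; adj = λ i j → not (toℕ i ≡ᵇ toℕ j) ∧ prodZero n (lookup (zeroDivisors n) i) (lookup (zeroDivisors n) j)
  }

_⊕_ : Graph → Graph → Graph
G ⊕ H = record { N = N G + N H ; adj = a }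
  where
  a : Fin (N G + N H) → Fin (N G + N H) → Bool
  a x y with splitAt (N G) x | splitAt (N G) y
  ... | inj₁ u | inj₁ v = adj G u v
  ... | inj₂ u | inj₂ v = adj H u v
  ... | inj₁ _ | inj₂ _ = true
  ... | inj₂ _ | inj₁ _ = true

-- Label of vertex v under the bijection f : V → {1..N} encoded as a permutation of Fin N:
-- label v = 1 + f(v).
label : ∀ {n} → Permutation′ n → Fin n → ℕ
label f v = suc (toℕ (f ⟨$⟩ʳ v))

weight : (G : Graph) → Permutation′ (N G) → Fin (N G) → ℕ
weight G f v = sum (map (λ u → if adj G v u then label f u else 0) (allFin (N G)))

IsDAML : (G : Graph) → Permutation′ (N G) → Set
IsDAML G f = Injective _≡_ _≡_ (weight G f)

AdmitsDAML : Graph → Set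
AdmitsDAML G = Σ (Permutation′ (N G)) (IsDAML G)

-- The residues 2 and 4 of ℤ_{2m} (m odd, m ≥ 3) have the same annihilator, namely the
-- multiples of m, and 2·4 = 8 ≢ 0 (mod 2m). So they are distinct non-adjacent vertices of
-- Γ(ℤ_{2m}) with the same open neighbourhood, and this stays true in any join with
-- Γ(ℤ_{2m}) on the left. Twin vertices receive equal weights under every labeling.
module Submission where

open import Defs
open import Data.Nat using (ℕ; _*_; _≤_)
open import Data.Nat.Primality using (Prime)
open import Relation.Nullary using (¬_)

open import Data.Bool using (true; false; T; T?; if_then_else_)
open import Data.Fin using (Fin; toℕ; splitAt; _↑ˡ_)
open import Data.Fin.Permutation using (Permutation′)
open import Data.Fin.Properties using (splitAt-↑ˡ; ↑ˡ-injective; toℕ-injective)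
open import Data.List using (List; lookup; allFin)
open import Data.List.Properties using (map-cong)
open import Data.List.Membership.Propositional using (_∈_; lose)
open import Data.List.Membership.Propositional.Properties using (∈-filter⁺; ∈-applyUpTo⁺)
open import Data.List.Relation.Unary.Any using (index)
open import Data.List.Relation.Unary.Any.Properties using (any⁺; lookup-index)
open import Data.Nat using (suc; _<_; _≡ᵇ_; s≤s; z≤n; >-nonZero)
open import Data.Nat.Coprimality using (Coprime; coprime-divisor; prime⇒coprime)
open import Data.Nat.Divisibility
  using (_∣_; _∣?_; divides; ∣-trans; ∣⇒≤; *-cancelˡ-∣; *-monoʳ-∣; ∣-refl)
open import Data.Nat.Properties using (*-assoc; *-comm; *-monoʳ-≤; ≡ᵇ⇒≡; ≤-trans; <-trans; <⇒≤; m<m*n)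
open import Data.Nat.ListAction using (sum)
open import Data.Product using (_,_)
open import Data.Sum using (inj₁; inj₂)
open import Function.Bundles using (_⇔_; mk⇔)
open import Relation.Binary.PropositionalEquality
open import Relation.Nullary using (does)
open import Relation.Nullary.Decidable using (⌊_⌋; fromWitness; isYes≗does; does-⇔; dec-false)

Twins : (G : Graph) → Fin (N G) → Fin (N G) → Set
Twins G v w = ∀ u → adj G v u ≡ adj G w u

weight-twins : ∀ {G} (f : Permutation′ (N G)) {v w} → Twins G v w → weight G f v ≡ weight G f w
weight-twins {G} f tw =
  cong sum (map-cong (λ u → cong (λ b → if b then label f u else 0) (tw u)) (allFin (N G)))

twins⇒¬AdmitsDAML : ∀ {G v w} → v ≢ w → Twins G v w → ¬ AdmitsDAML G
twins⇒¬AdmitsDAML {G} v≢w tw (f , distinct) = v≢w (distinct (weight-twins {G} f tw))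

⊕-twinsˡ : ∀ {G} H {v w} → Twins G v w → Twins (G ⊕ H) (v ↑ˡ N H) (w ↑ˡ N H)
⊕-twinsˡ {G} H {v} {w} tw u
  rewrite splitAt-↑ˡ (N G) v (N H) | splitAt-↑ˡ (N G) w (N H) with splitAt (N G) u
... | inj₁ x = tw x
... | inj₂ _ = refl

prodZero-comm : ∀ n a b → prodZero n a b ≡ prodZero n b a
prodZero-comm n a b = cong (λ k → ⌊ n ∣? k ⌋) (*-comm a b)

prodZero-⇔ : ∀ {n a b c} → n ∣ a * c ⇔ n ∣ b * c → prodZero n a c ≡ prodZero n b c
prodZero-⇔ {n} {a} {b} {c} a⇔b = begin
  ⌊ n ∣? a * c ⌋    ≡⟨ isYes≗does (n ∣? a * c) ⟩
  does (n ∣? a * c) ≡⟨ does-⇔ a⇔b (n ∣? a * c) (n ∣? b * c) ⟩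
  does (n ∣? b * c) ≡⟨ sym (isYes≗does (n ∣? b * c)) ⟩
  ⌊ n ∣? b * c ⌋    ∎
  where open ≡-Reasoning

prodZero-∤ : ∀ {n a b} → ¬ n ∣ a * b → prodZero n a b ≡ false
prodZero-∤ {n} {a} {b} n∤ab = trans (isYes≗does (n ∣? a * b)) (dec-false (n ∣? a * b) n∤ab)

∈-nonzeroRes : ∀ {a n} → 0 < a → a < n → a ∈ nonzeroRes n
∈-nonzeroRes {suc i} {suc n} _ (s≤s i<n) = ∈-applyUpTo⁺ suc i<n

∈-zeroDivisors : ∀ {n a b} → 0 < a → a < n → 0 < b → b < n → n ∣ a * b → a ∈ zeroDivisors n
∈-zeroDivisors {n} {a} 0<a a<n 0<b b<n n∣ab =
  ∈-filter⁺ (λ x → T? (isZD n x)) (∈-nonzeroRes 0<a a<n)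
    (any⁺ (prodZero n a) (lose (∈-nonzeroRes 0<b b<n) (fromWitness n∣ab)))

index-≢ : ∀ {A : Set} {xs : List A} {a b} (a∈ : a ∈ xs) (b∈ : b ∈ xs) → a ≢ b → index a∈ ≢ index b∈
index-≢ {xs = xs} {a} {b} a∈ b∈ a≢b e = a≢b (begin
  a                     ≡⟨ lookup-index a∈ ⟩
  lookup xs (index a∈)  ≡⟨ cong (lookup xs) e ⟩
  lookup xs (index b∈)  ≡⟨ lookup-index b∈ ⟨
  b                     ∎)
  where open ≡-Reasoning

residue : (n : ℕ) → Fin (N (Γℤ n)) → ℕ
residue n = lookup (zeroDivisors n)

≡ᵇ-true⇒≡ : ∀ {k} {i u : Fin k} → (toℕ i ≡ᵇ toℕ u) ≡ true → i ≡ u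
≡ᵇ-true⇒≡ e = toℕ-injective (≡ᵇ⇒≡ _ _ (subst T (sym e) _))

Γℤ-twins : ∀ {n} {i j : Fin (N (Γℤ n))} →
           (∀ c → prodZero n (residue n i) c ≡ prodZero n (residue n j) c) →
           prodZero n (residue n i) (residue n j) ≡ false →
           Twins (Γℤ n) i j
Γℤ-twins {n} {i} {j} sameAnn nonAdj u with toℕ i ≡ᵇ toℕ u in i≡u | toℕ j ≡ᵇ toℕ u in j≡u
... | true  | true  = refl
... | false | false = sameAnn (residue n u)
... | true  | false with refl ← ≡ᵇ-true⇒≡ {i = i} {u} i≡u =
  sym (trans (prodZero-comm n (residue n j) (residue n i)) nonAdj)
... | false | true  with refl ← ≡ᵇ-true⇒≡ {i = j} {u} j≡u = nonAdj

Γℤ-twins-∈ : ∀ {n a b} (a∈ : a ∈ zeroDivisors n) (b∈ : b ∈ zeroDivisors n) →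
             (∀ c → prodZero n a c ≡ prodZero n b c) → prodZero n a b ≡ false →
             Twins (Γℤ n) (index a∈) (index b∈)
Γℤ-twins-∈ {n} {a} {b} a∈ b∈ sameAnn nonAdj =
  Γℤ-twins {n} (λ c → atResidues (λ x y → prodZero n x c ≡ prodZero n y c) (sameAnn c))
               (atResidues (λ x y → prodZero n x y ≡ false) nonAdj)
  where
  atResidues : (P : ℕ → ℕ → Set) → P a b → P (residue n (index a∈)) (residue n (index b∈))
  atResidues P = subst₂ P (lookup-index a∈) (lookup-index b∈)

module _ {m : ℕ} (m⊥2 : Coprime m 2) where

  2m∣4c⇒2m∣2c : ∀ c → 2 * m ∣ 4 * c → 2 * m ∣ 2 * c
  2m∣4c⇒2m∣2c c 2m∣4c =
    *-monoʳ-∣ {m} {c} 2 (coprime-divisor m⊥2 (*-cancelˡ-∣ {m} 2 (subst (2 * m ∣_) (*-assoc 2 2 c) 2m∣4c)))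

  annihilator-2≡4 : ∀ c → prodZero (2 * m) 2 c ≡ prodZero (2 * m) 4 c
  annihilator-2≡4 c = prodZero-⇔ {2 * m} {2} {4} {c} (mk⇔ (λ d → ∣-trans d 2c∣4c) (2m∣4c⇒2m∣2c c))
    where
    2c∣4c : 2 * c ∣ 4 * c
    2c∣4c = divides 2 (*-assoc 2 2 c)

  2m∤8 : 2 ≤ m → ¬ 2 * m ∣ 8
  2m∤8 2≤m 2m∣8 with ∣⇒≤ (2m∣4c⇒2m∣2c 1 (2m∣4c⇒2m∣2c 2 2m∣8)) | *-monoʳ-≤ 2 2≤m
  ... | 2m≤2 | 4≤2m with ≤-trans 4≤2m 2m≤2
  ... | s≤s (s≤s ())

  module _ (3≤m : 3 ≤ m) where

    0<m : 0 < m
    0<m = ≤-trans (s≤s z≤n) 3≤m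

    m<2m : m < 2 * m
    m<2m = subst (m <_) (*-comm m 2) (m<m*n m 2 ⦃ >-nonZero 0<m ⦄ (s≤s (s≤s z≤n)))

    4<2m : 4 < 2 * m
    4<2m = ≤-trans (s≤s (s≤s (s≤s (s≤s (s≤s z≤n))))) (*-monoʳ-≤ 2 3≤m)

    2m-zeroDivisor : ∀ {a} → 0 < a → a < 2 * m → 2 * m ∣ a * m → a ∈ zeroDivisors (2 * m)
    2m-zeroDivisor 0<a a<2m = ∈-zeroDivisors 0<a a<2m 0<m m<2m

    2∈ : 2 ∈ zeroDivisors (2 * m)
    2∈ = 2m-zeroDivisor (s≤s z≤n) (<-trans (s≤s (s≤s (s≤s z≤n))) 4<2m) ∣-refl

    4∈ : 4 ∈ zeroDivisors (2 * m)
    4∈ = 2m-zeroDivisor (s≤s z≤n) 4<2m (divides 2 (*-assoc 2 2 m))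

    Γℤ2m⊕-¬AdmitsDAML : ∀ H → ¬ AdmitsDAML (Γℤ (2 * m) ⊕ H)
    Γℤ2m⊕-¬AdmitsDAML H = twins⇒¬AdmitsDAML {Γℤ (2 * m) ⊕ H}
      (λ e → index-≢ 2∈ 4∈ (λ ()) (↑ˡ-injective (N H) _ _ e))
      (⊕-twinsˡ H (Γℤ-twins-∈ 2∈ 4∈ annihilator-2≡4 (prodZero-∤ {2 * m} {2} {4} (2m∤8 (<⇒≤ 3≤m)))))

theorem2p1 : (m : ℕ) → Prime m → 3 ≤ m → ¬ AdmitsDAML (Γℤ (2 * m) ⊕ Γℤ 4)
theorem2p1 m m-prime 3≤m = Γℤ2m⊕-¬AdmitsDAML (prime⇒coprime m-prime 3≤m) 3≤m (Γℤ 4)
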